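{- There is a polynomial-delay and polynomial-space algorithm which, given an XOR-CNF formula, lists all its minimal signatures if and only if there is a polynomial-delay and polynomial-space algorithm which, given an XOR-CNF formula, lists all its maximal signatures.
   Context: An XOR-clause over Boolean variables $V$ is a linear equation $x_{i_1} + \dots + x_{i_k} = \varepsilon$ over $\mathrm{GF}(2)$, $\varepsilon\in\{0,1\}$. An XOR-CNF is a conjunction $\varphi = C_1\land\dots\land C_m$ of XOR-clauses. For an assignment $a\colon V\to\{0,1\}$, $C_i(a)=1$ if $C_i$ holds under $a$ and $0$ otherwise; the signature produced by $a$ is $(C_1(a),\dots,C_m(a))\in\{0,1\}^m$, and the signatures of $\varphi$ are all sequences so produced. Sequences in $\{0,1\}^m$ are ordered bitwise: $\sigma\le\tau$ iff $\sigma[i]\le\tau[i]$ for all $i$. A minimal (resp. maximal) signature is a signature that is minimal (resp. maximal) for $\le$ among all signatures of $\varphi$. Polynomial delay: time before the first output, between consecutive outputs and after the last output is polynomial in the input size; polynomial space: working memory polynomial in the input size. -}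

module Defs where

open import Data.Nat using (ℕ; zero; suc; _+_; _^_; _≤_)
open import Data.Bool using (Bool; true; false; _xor_; _∧_)
open import Data.Fin using (Fin; zero; suc; toℕ)
open import Data.List using (List; []; _∷_; _++_; [_]; length; foldr; map; replicate; concatMap)
open import Data.List.Relation.Unary.Unique.Propositional using (Unique)
open import Data.List.Membership.Propositional using (_∈_)
open import Data.List.Relation.Binary.Pointwise using (Pointwise)
open import Data.Maybe using (Maybe; just; nothing)
open import Data.Product using (Σ; ∃; _×_; _,_; ∃-syntax)
open import Relation.Binary.PropositionalEquality using (_≡_)
open import Function.Bundles using (_⇔_)

-- An XOR-clause over variables Fin n: the list of variables x_{i_1},…,x_{i_k}
-- together with the right-hand side ε.
XorClause : ℕ → Set
XorClause n = List (Fin n) × Bool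

record XorCNF : Set where
  constructor xorCNF
  field
    nVars   : ℕ
    clauses : List (XorClause nVars)
open XorCNF public

Assignment : ℕ → Set
Assignment n = Fin n → Bool

parity : ∀ {n} → Assignment n → List (Fin n) → Bool
parity a = foldr (λ i acc → a i xor acc) false

beq : Bool → Bool → Bool
beq true  b = b
beq false b = Data.Bool.not b

evalClause : ∀ {n} → Assignment n → XorClause n → Bool
evalClause a (xs , ε) = beq (parity a xs) ε

signatureOf : (φ : XorCNF) → Assignment (nVars φ) → List Bool
signatureOf φ a = map (evalClause a) (clauses φ)

IsSignature : XorCNF → List Bool → Set
IsSignature φ σ = ∃[ a ] (signatureOf φ a ≡ σ)

data _≤B_ : Bool → Bool → Set where
  f≤b : ∀ {b} → false ≤B b
  t≤t : true ≤B true

_≤S_ : List Bool → List Bool → Set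
σ ≤S τ = Pointwise _≤B_ σ τ

IsMinimalSignature : XorCNF → List Bool → Set
IsMinimalSignature φ σ =
  IsSignature φ σ × (∀ τ → IsSignature φ τ → τ ≤S σ → τ ≡ σ)

IsMaximalSignature : XorCNF → List Bool → Set
IsMaximalSignature φ σ =
  IsSignature φ σ × (∀ τ → IsSignature φ τ → σ ≤S τ → τ ≡ σ)

encℕ : ℕ → List Bool
encℕ k = replicate k true ++ [ false ]

encList : ∀ {A : Set} → (A → List Bool) → List A → List Bool
encList e []       = [ false ]
encList e (x ∷ xs) = true ∷ e x ++ encList e xs

encClause : ∀ {n} → XorClause n → List Bool
encClause (xs , ε) = ε ∷ encList (λ i → encℕ (toℕ i)) xs

encode : XorCNF → List Bool
encode φ = encℕ (nVars φ) ++ encList encClause (clauses φ)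

-- Model of computation: deterministic single-tape Turing machine with
-- a read-only-free work tape (holding the input initially) and a
-- write-only output buffer.  A transition may append a bit to the output
-- buffer, or "flush" it, which emits the buffer content as one output item.

-- tape alphabet: zero = blank, 1 = bit 0, 2 = bit 1, plus k extra symbols
Γ : ℕ → Set
Γ k = Fin (3 + k)

blank : ∀ {k} → Γ k
blank = zero

bitSym : ∀ {k} → Bool → Γ k
bitSym false = suc zero
bitSym true  = suc (suc zero)

data Move : Set where
  left right stay : Move

data OutAct : Set where
  none  : OutAct
  emitBit : Bool → OutAct
  flush : OutAct

record TM : Set where
  field
    nStates : ℕ        -- states are Fin (suc nStates); zero is initial
    nExtra  : ℕ
    δ : Fin (suc nStates) → Γ nExtra → Maybe (Fin (suc nStates) × Γ nExtra × Move × OutAct)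
    -- nothing = halt

module _ (M : TM) where
  open TM M

  record Config : Set where
    constructor conf
    field
      state : Fin (suc nStates)
      lt    : List (Γ nExtra)   -- cells left of the head, nearest first
      hd    : Γ nExtra
      rt    : List (Γ nExtra)
      buf   : List Bool
  open Config

  -- number of tape cells visited so far
  space : Config → ℕ
  space c = length (lt c) + suc (length (rt c))

  initConfig : List Bool → Config
  initConfig []       = conf zero [] blank [] []
  initConfig (b ∷ bs) = conf zero [] (bitSym b) (map bitSym bs) []

  moveHead : Move → List (Γ nExtra) → Γ nExtra → List (Γ nExtra)
           → List (Γ nExtra) × Γ nExtra × List (Γ nExtra)
  moveHead left  []       h r        = [] , h , r
  moveHead left  (x ∷ l)  h r        = l , x , h ∷ r
  moveHead right l        h []       = h ∷ l , blank , []
  moveHead right l        h (x ∷ r)  = h ∷ l , x , r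
  moveHead stay  l        h r        = l , h , r

  doOut : OutAct → List Bool → List Bool × Maybe (List Bool)
  doOut none        bf = bf , nothing
  doOut (emitBit b) bf = bf ++ [ b ] , nothing
  doOut flush       bf = [] , just bf

  step : Config → Maybe (Config × Maybe (List Bool))
  step (conf q l h r bf) with δ q h
  ... | nothing = nothing
  ... | just (q' , w , mv , o) with moveHead mv l w r | doOut o bf
  ...   | (l' , h' , r') | (bf' , out) = just (conf q' l' h' r' bf' , out)

  -- Runs d s t c outs : started in configuration c, where t steps have
  -- elapsed since the last output (or since the start), the machine halts,
  -- emitting exactly the sequence outs; every configuration uses at most s
  -- tape cells, and at most d steps elapse before the first output, between
  -- consecutive outputs, and after the last output until halting.
  data Runs (d s : ℕ) : ℕ → Config → List (List Bool) → Set where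
    halts  : ∀ {t c} → step c ≡ nothing → space c ≤ s → t ≤ d → Runs d s t c []
    silent : ∀ {t c c' outs} → step c ≡ just (c' , nothing) → space c ≤ s →
             Runs d s (suc t) c' outs → Runs d s t c outs
    emits  : ∀ {t c c' o outs} → step c ≡ just (c' , just o) → space c ≤ s →
             suc t ≤ d → Runs d s 0 c' outs → Runs d s t c (o ∷ outs)

ListsWithin : TM → (x : List Bool) → (List Bool → Set) → ℕ → ℕ → Set
ListsWithin M x P d s =
  ∃[ outs ] (Runs M d s 0 (initConfig M x) outs × Unique outs × (∀ σ → (σ ∈ outs ⇔ P σ)))

PolyDelaySpaceEnumerable : (XorCNF → List Bool → Set) → Set
PolyDelaySpaceEnumerable P =
  ∃[ M ] ∃[ c ] (∀ φ → ListsWithin M (encode φ) (P φ)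
                        ((length (encode φ) + 2) ^ c) ((length (encode φ) + 2) ^ c))

-- Negating the right-hand side of every clause complements every signature, and complementation
-- reverses the bitwise order; so the maximal signatures of φ are exactly the complements of the
-- minimal signatures of φ with all right-hand sides negated, and vice versa.  An enumerator for one
-- kind thus yields one for the other: the new machine first rewrites its input in place, turning
-- the encoding of φ into that of the negated formula (one left-to-right pass of a finite transducer
-- flipping the ε bits, one pass back, fewer than 2|input| steps and no new cells), and then
-- simulates the old machine, complementing every output bit.  This only adds a linear term to the
-- delay, which raising the exponent by 2 absorbs.
module Submission where

open import Data.Bool using (Bool; true; false; not)
open import Data.Bool.Properties using (not-involutive; not-injective)
open import Data.Fin using (Fin; zero; suc; toℕ)
open import Data.List using (List; []; _∷_; _++_; [_]; map; length; _ʳ++_)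
open import Data.List.Properties using (map-injective; map-∘; map-cong; map-++; length-map; ++-assoc)
open import Data.List.Membership.Propositional using (_∈_)
open import Data.List.Membership.Propositional.Properties using (∈-map⁺; ∈-map⁻)
open import Data.List.Relation.Binary.Pointwise using ([]; _∷_)
import Data.List.Relation.Unary.Unique.Propositional.Properties as Unique
open import Data.Maybe using (Maybe; just; nothing)
import Data.Maybe as Maybe
open import Data.Nat using (ℕ; zero; suc; _+_; _*_; _^_; _≤_; s≤s; z≤n; >-nonZero)
open import Data.Nat.Properties
  using ( ≤-refl; ≤-reflexive; ≤-trans; +-suc; +-identityʳ; n≤1+n; +-monoˡ-≤; +-monoʳ-≤
        ; m≤m+n; m≤n+m; m≤m*n; m^n≢0; module ≤-Reasoning)
open import Data.Nat.Tactic.RingSolver using (solve-∀)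
open import Data.Product using (∃-syntax; _×_; _,_)
import Data.Product as Product
open import Function using (_∘_; flip)
open import Function.Bundles using (_⇔_; mk⇔; Equivalence)
import Function.Properties.Equivalence as ⇔
open import Relation.Binary.PropositionalEquality
  using (_≡_; refl; sym; trans; cong; cong₂; subst; subst₂; module ≡-Reasoning)

open import Defs

complement : List Bool → List Bool
complement = map not

complement-involutive : ∀ σ → complement (complement σ) ≡ σ
complement-involutive []      = refl
complement-involutive (b ∷ σ) = cong₂ _∷_ (not-involutive b) (complement-involutive σ)

complement-injective : ∀ {σ τ} → complement σ ≡ complement τ → σ ≡ τ
complement-injective = map-injective not-injective

complement-antitone : ∀ {σ τ} → σ ≤S τ → complement τ ≤S complement σ
complement-antitone []                = []
complement-antitone (f≤b {false} ∷ p) = t≤t ∷ complement-antitone p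
complement-antitone (f≤b {true}  ∷ p) = f≤b ∷ complement-antitone p
complement-antitone (t≤t ∷ p)         = f≤b ∷ complement-antitone p

complement-antitone-⇔ : ∀ {σ τ} → σ ≤S τ ⇔ complement τ ≤S complement σ
complement-antitone-⇔ {σ} {τ} = mk⇔ complement-antitone λ p →
  subst₂ _≤S_ (complement-involutive σ) (complement-involutive τ) (complement-antitone p)

∈-map-complement : ∀ {σ} (outs : List (List Bool)) → σ ∈ map complement outs ⇔ complement σ ∈ outs
∈-map-complement {σ} outs = mk⇔ to from
  where
  to : σ ∈ map complement outs → complement σ ∈ outs
  to σ∈ with ∈-map⁻ complement σ∈
  ... | τ , τ∈ , refl = subst (_∈ outs) (sym (complement-involutive τ)) τ∈
  from : complement σ ∈ outs → σ ∈ map complement outs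
  from cσ∈ = subst (_∈ map complement outs) (complement-involutive σ) (∈-map⁺ complement cσ∈)

-- IsMinimalSignature φ and IsMaximalSignature φ are, definitionally,
-- Minimal _≤S_ (IsSignature φ) and Minimal (flip _≤S_) (IsSignature φ).
Minimal : (List Bool → List Bool → Set) → (List Bool → Set) → List Bool → Set
Minimal _≼_ S σ = S σ × (∀ τ → S τ → τ ≼ σ → τ ≡ σ)

Minimal-complement : ∀ (_≼_ _≼′_ : List Bool → List Bool → Set) (S S′ : List Bool → Set) →
                     (∀ σ → S′ σ ⇔ S (complement σ)) →
                     (∀ σ τ → σ ≼′ τ ⇔ complement σ ≼ complement τ) →
                     ∀ σ → Minimal _≼_ S σ ⇔ Minimal _≼′_ S′ (complement σ)
Minimal-complement _≼_ _≼′_ S S′ S′⇔S ≼′⇔≼ σ = mk⇔ minimal⇒ minimal⇐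
  where
  open Equivalence
  cc = complement-involutive

  minimal⇒ : Minimal _≼_ S σ → Minimal _≼′_ S′ (complement σ)
  minimal⇒ (Sσ , least) =
    from (S′⇔S (complement σ)) (subst S (sym (cc σ)) Sσ) , λ τ S′τ τ≼′cσ →
    let cτ≼σ = subst (complement τ ≼_) (cc σ) (to (≼′⇔≼ τ (complement σ)) τ≼′cσ)
    in trans (sym (cc τ)) (cong complement (least (complement τ) (to (S′⇔S τ) S′τ) cτ≼σ))

  minimal⇐ : Minimal _≼′_ S′ (complement σ) → Minimal _≼_ S σ
  minimal⇐ (S′cσ , least) = subst S (cc σ) (to (S′⇔S (complement σ)) S′cσ) , λ τ Sτ τ≼σ →
    let S′cτ   = from (S′⇔S (complement τ)) (subst S (sym (cc τ)) Sτ)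
        cτ≼′cσ = from (≼′⇔≼ (complement τ) (complement σ))
                      (subst₂ _≼_ (sym (cc τ)) (sym (cc σ)) τ≼σ)
    in complement-injective (least (complement τ) S′cτ cτ≼′cσ)

negateRHS : XorCNF → XorCNF
negateRHS φ = xorCNF (nVars φ) (map (Product.map₂ not) (clauses φ))

evalClause-negateRHS : ∀ {n} (a : Assignment n) C →
                       evalClause a (Product.map₂ not C) ≡ not (evalClause a C)
evalClause-negateRHS a (xs , ε) with parity a xs
... | true  = refl
... | false = refl

signatureOf-negateRHS : ∀ φ a → signatureOf (negateRHS φ) a ≡ complement (signatureOf φ a)
signatureOf-negateRHS φ a = begin
  map (evalClause a) (map (Product.map₂ not) (clauses φ))  ≡⟨ map-∘ (clauses φ) ⟨
  map (evalClause a ∘ Product.map₂ not) (clauses φ)        ≡⟨ map-cong (evalClause-negateRHS a) (clauses φ) ⟩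
  map (not ∘ evalClause a) (clauses φ)                     ≡⟨ map-∘ (clauses φ) ⟩
  complement (signatureOf φ a)                             ∎
  where open ≡-Reasoning

IsSignature-negateRHS : ∀ φ σ → IsSignature (negateRHS φ) σ ⇔ IsSignature φ (complement σ)
IsSignature-negateRHS φ σ = mk⇔
  (λ (a , sig≡σ) → a , trans (sym (complement-involutive _))
                              (cong complement (trans (sym (signatureOf-negateRHS φ a)) sig≡σ)))
  (λ (a , sig≡cσ) → a , trans (signatureOf-negateRHS φ a)
                               (trans (cong complement sig≡cσ) (complement-involutive σ)))

IsMaximalSignature⇔IsMinimalSignature-negateRHS :
  ∀ φ σ → IsMaximalSignature φ σ ⇔ IsMinimalSignature (negateRHS φ) (complement σ)
IsMaximalSignature⇔IsMinimalSignature-negateRHS φ =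
  Minimal-complement (flip _≤S_) _≤S_ (IsSignature φ) (IsSignature (negateRHS φ))
                     (IsSignature-negateRHS φ) (λ _ _ → complement-antitone-⇔)

IsMinimalSignature⇔IsMaximalSignature-negateRHS :
  ∀ φ σ → IsMinimalSignature φ σ ⇔ IsMaximalSignature (negateRHS φ) (complement σ)
IsMinimalSignature⇔IsMaximalSignature-negateRHS φ =
  Minimal-complement _≤S_ (flip _≤S_) (IsSignature φ) (IsSignature (negateRHS φ))
                     (IsSignature-negateRHS φ) (λ _ _ → complement-antitone-⇔)

data Silent (N : TM) (s : ℕ) : Config N → ℕ → Config N → Set where
  done : ∀ {c} → Silent N s c 0 c
  next : ∀ {c c' k c''} → step N c ≡ just (c' , nothing) → space N c ≤ s →
         Silent N s c' k c'' → Silent N s c (suc k) c''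

module _ {N : TM} {d s : ℕ} where

  Runs-prepend : ∀ {c k c' t outs} → Silent N s c k c' → Runs N d s (k + t) c' outs → Runs N d s t c outs
  Runs-prepend done                                        run = run
  Runs-prepend {k = suc k} {c'} {t} {outs} (next eq sp steps) run =
    silent eq sp (Runs-prepend steps (subst (λ t′ → Runs N d s t′ c' outs) (sym (+-suc k t)) run))

  Runs-delay : ∀ {k t t' c outs} → t' ≤ t + k → Runs N d s t c outs → Runs N (d + k) s t' c outs
  Runs-delay {k} t'≤ (halts eq sp t≤d)     = halts eq sp (≤-trans t'≤ (+-monoˡ-≤ k t≤d))
  Runs-delay     t'≤ (silent eq sp run)    = silent eq sp (Runs-delay (s≤s t'≤) run)
  Runs-delay {k} t'≤ (emits eq sp t≤d run) =
    emits eq sp (≤-trans (s≤s t'≤) (+-monoˡ-≤ k t≤d)) (Runs-delay z≤n run)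

  Runs-mono : ∀ {d' s' t c outs} → d ≤ d' → s ≤ s' → Runs N d s t c outs → Runs N d' s' t c outs
  Runs-mono d≤ s≤ (halts eq sp t≤d)     = halts eq (≤-trans sp s≤) (≤-trans t≤d d≤)
  Runs-mono d≤ s≤ (silent eq sp run)    = silent eq (≤-trans sp s≤) (Runs-mono d≤ s≤ run)
  Runs-mono d≤ s≤ (emits eq sp t≤d run) =
    emits eq (≤-trans sp s≤) (≤-trans t≤d d≤) (Runs-mono d≤ s≤ run)

  Runs-simulate : ∀ {N′ : TM} (f : Config N → Config N′) (g : List Bool → List Bool) →
                  (∀ c → step N′ (f c) ≡ Maybe.map (Product.map f (Maybe.map g)) (step N c)) →
                  (∀ c → space N′ (f c) ≤ space N c) →
                  ∀ {t c outs} → Runs N d s t c outs → Runs N′ d s t (f c) (map g outs)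
  Runs-simulate {N′} f g step-f space-f = simulate
    where
    step′ : ∀ {c r} → step N c ≡ r → step N′ (f c) ≡ Maybe.map (Product.map f (Maybe.map g)) r
    step′ eq = trans (step-f _) (cong (Maybe.map _) eq)
    space′ : ∀ {c} → space N c ≤ s → space N′ (f c) ≤ s
    space′ = ≤-trans (space-f _)
    simulate : ∀ {t c outs} → Runs N d s t c outs → Runs N′ d s t (f c) (map g outs)
    simulate (halts eq sp t≤d)     = halts (step′ eq) (space′ sp) t≤d
    simulate (silent eq sp run)    = silent (step′ eq) (space′ sp) (simulate run)
    simulate (emits eq sp t≤d run) = emits (step′ eq) (space′ sp) t≤d (simulate run)

ListsWithin-mono : ∀ {N x P d d' s s'} → d ≤ d' → s ≤ s' →
                   ListsWithin N x P d s → ListsWithin N x P d' s'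
ListsWithin-mono d≤ s≤ (outs , run , unique , spec) = outs , Runs-mono d≤ s≤ run , unique , spec

poly-slack : ∀ L c → (L + 2) ^ c + (L + L) ≤ (L + 2) ^ (2 + c)
poly-slack L c = begin
  x + (L + L)                               ≤⟨ +-monoʳ-≤ x (m≤m*n (L + L) x {{x≢0}}) ⟩
  x + (L + L) * x                           ≤⟨ m≤m+n _ ((L * L + 2 * L + 3) * x) ⟩
  x + (L + L) * x + (L * L + 2 * L + 3) * x ≡⟨ expand L x ⟩
  (L + 2) * ((L + 2) * x)                   ∎
  where
  open ≤-Reasoning
  x = (L + 2) ^ c
  x≢0 = m^n≢0 (L + 2) c {{>-nonZero (≤-trans (s≤s z≤n) (m≤n+m 2 L))}}
  expand : ∀ L x → x + (L + L) * x + (L * L + 2 * L + 3) * x ≡ (L + 2) * ((L + 2) * x)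
  expand = solve-∀

-- A finite transducer reading encode φ field by field (the unary nVars, then each clause: its tag
-- bit, its ε, its variables as tagged unary numbers) and complementing exactly the ε bits.
data Position : Set where
  inNVars atClause atRHS atVar inVar : Position

negator : Position → Bool → Bool × Maybe Position
negator inNVars  true  = true , just inNVars
negator inNVars  false = false , just atClause
negator atClause true  = true , just atRHS
negator atClause false = false , nothing
negator atRHS    b     = not b , just atVar
negator atVar    true  = true , just inVar
negator atVar    false = false , just atClause
negator inVar    true  = true , just inVar
negator inVar    false = false , just atVar

data Transduces : Position → List Bool → List Bool → Set where
  finish  : ∀ {p b b'} → negator p b ≡ (b' , nothing) → Transduces p [ b ] [ b' ]
  advance : ∀ {p b b' p' w w'} → negator p b ≡ (b' , just p') → Transduces p' w w' →
            Transduces p (b ∷ w) (b' ∷ w')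

Transduces-length : ∀ {p w w'} → Transduces p w w' → length w' ≡ length w
Transduces-length (finish _)    = refl
Transduces-length (advance _ t) = cong suc (Transduces-length t)

transduces-encℕ : ∀ {p q w w'} →
                  negator p true ≡ (true , just p) → negator p false ≡ (false , just q) →
                  ∀ k → Transduces q w w' → Transduces p (encℕ k ++ w) (encℕ k ++ w')
transduces-encℕ on1 on0 zero    t = advance on0 t
transduces-encℕ on1 on0 (suc k) t = advance on1 (transduces-encℕ on1 on0 k t)

transduces-vars : ∀ {n w w'} (xs : List (Fin n)) → Transduces atClause w w' →
                  Transduces atVar (encList (λ i → encℕ (toℕ i)) xs ++ w)
                                   (encList (λ i → encℕ (toℕ i)) xs ++ w')
transduces-vars []       t = advance refl t
transduces-vars {w = w} {w'} (x ∷ xs) t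
  rewrite ++-assoc (encℕ (toℕ x)) (encList (λ i → encℕ (toℕ i)) xs) w
        | ++-assoc (encℕ (toℕ x)) (encList (λ i → encℕ (toℕ i)) xs) w'
  = advance refl (transduces-encℕ refl refl (toℕ x) (transduces-vars xs t))

transduces-clauses : ∀ {n} (cs : List (XorClause n)) →
                     Transduces atClause (encList encClause cs)
                                         (encList encClause (map (Product.map₂ not) cs))
transduces-clauses []              = finish refl
transduces-clauses ((xs , ε) ∷ cs) = advance refl (advance refl (transduces-vars xs (transduces-clauses cs)))

transduces-encode : ∀ φ → Transduces inNVars (encode φ) (encode (negateRHS φ))
transduces-encode φ = transduces-encℕ refl refl (nVars φ) (transduces-clauses (clauses φ))

length-encode-negateRHS : ∀ φ → length (encode (negateRHS φ)) ≡ length (encode φ)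
length-encode-negateRHS φ = Transduces-length (transduces-encode φ)

module Complementing (M : TM) where
  open TM M

  data Phase : Set where
    marking   : Phase
    scanning  : Position → Phase
    rewinding : Phase
    running   : Fin (suc nStates) → Phase

  State : Set
  State = Fin (8 + nStates)

  encodePhase : Phase → State
  encodePhase marking             = zero
  encodePhase (scanning inNVars)  = suc zero
  encodePhase (scanning atClause) = suc (suc zero)
  encodePhase (scanning atRHS)    = suc (suc (suc zero))
  encodePhase (scanning atVar)    = suc (suc (suc (suc zero)))
  encodePhase (scanning inVar)    = suc (suc (suc (suc (suc zero))))
  encodePhase rewinding           = suc (suc (suc (suc (suc (suc zero)))))
  encodePhase (running q)         = suc (suc (suc (suc (suc (suc (suc q))))))

  decodePhase : State → Phase
  decodePhase zero                                        = marking
  decodePhase (suc zero)                                  = scanning inNVars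
  decodePhase (suc (suc zero))                            = scanning atClause
  decodePhase (suc (suc (suc zero)))                      = scanning atRHS
  decodePhase (suc (suc (suc (suc zero))))                = scanning atVar
  decodePhase (suc (suc (suc (suc (suc zero)))))          = scanning inVar
  decodePhase (suc (suc (suc (suc (suc (suc zero))))))    = rewinding
  decodePhase (suc (suc (suc (suc (suc (suc (suc q))))))) = running q

  decodePhase-encodePhase : ∀ ph → decodePhase (encodePhase ph) ≡ ph
  decodePhase-encodePhase marking             = refl
  decodePhase-encodePhase (scanning inNVars)  = refl
  decodePhase-encodePhase (scanning atClause) = refl
  decodePhase-encodePhase (scanning atRHS)    = refl
  decodePhase-encodePhase (scanning atVar)    = refl
  decodePhase-encodePhase (scanning inVar)    = refl
  decodePhase-encodePhase rewinding           = refl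
  decodePhase-encodePhase (running q)         = refl

  Symbol : Set
  Symbol = Γ (2 + nExtra)

  -- The first cell is overwritten by a marker remembering its bit: moving left on the first cell
  -- is a no-op, so without it the rewinding pass could not recognise the left end of the tape.
  marker : Bool → Symbol
  marker false = suc (suc (suc zero))
  marker true  = suc (suc (suc (suc zero)))

  embed : Γ nExtra → Symbol
  embed zero                = zero
  embed (suc zero)          = suc zero
  embed (suc (suc zero))    = suc (suc zero)
  embed (suc (suc (suc x))) = suc (suc (suc (suc (suc x))))

  unembed : Symbol → Maybe (Γ nExtra)
  unembed zero                            = just zero
  unembed (suc zero)                      = just (suc zero)
  unembed (suc (suc zero))                = just (suc (suc zero))
  unembed (suc (suc (suc zero)))          = nothing
  unembed (suc (suc (suc (suc zero))))    = nothing
  unembed (suc (suc (suc (suc (suc x))))) = just (suc (suc (suc x)))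

  unembed-embed : ∀ g → unembed (embed g) ≡ just g
  unembed-embed zero                = refl
  unembed-embed (suc zero)          = refl
  unembed-embed (suc (suc zero))    = refl
  unembed-embed (suc (suc (suc x))) = refl

  embed-bitSym : ∀ b → embed (bitSym b) ≡ bitSym b
  embed-bitSym false = refl
  embed-bitSym true  = refl

  Action : Set
  Action = Maybe (State × Symbol × Move × OutAct)

  onBit : (Bool → Action) → Symbol → Action
  onBit k (suc zero)       = k false
  onBit k (suc (suc zero)) = k true
  onBit k _                = nothing

  onBit-bitSym : ∀ k b → onBit k (bitSym b) ≡ k b
  onBit-bitSym k false = refl
  onBit-bitSym k true  = refl

  mark : Bool × Maybe Position → Action
  mark (b' , just p)  = just (encodePhase (scanning p) , marker b' , right , none)
  mark (b' , nothing) = nothing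

  scan : Bool × Maybe Position → Action
  scan (b' , just p)  = just (encodePhase (scanning p) , bitSym b' , right , none)
  scan (b' , nothing) = just (encodePhase rewinding , bitSym b' , left , none)

  rewind : Symbol → Action
  rewind (suc zero)                   = just (encodePhase rewinding , bitSym false , left , none)
  rewind (suc (suc zero))             = just (encodePhase rewinding , bitSym true , left , none)
  rewind (suc (suc (suc zero)))       = just (encodePhase (running zero) , bitSym false , stay , none)
  rewind (suc (suc (suc (suc zero)))) = just (encodePhase (running zero) , bitSym true , stay , none)
  rewind _                            = nothing

  complementOut : OutAct → OutAct
  complementOut none        = none
  complementOut (emitBit b) = emitBit (not b)
  complementOut flush       = flush

  run : Fin (suc nStates) → Maybe (Γ nExtra) → Action
  run q nothing  = nothing
  run q (just g) =
    Maybe.map (λ (q' , w , mv , o) → encodePhase (running q') , embed w , mv , complementOut o) (δ q g)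

  transition : Phase → Symbol → Action
  transition marking      = onBit (mark ∘ negator inNVars)
  transition (scanning p) = onBit (scan ∘ negator p)
  transition rewinding    = rewind
  transition (running q)  = run q ∘ unembed

  machine : TM
  machine = record { nStates = 7 + nStates ; nExtra = 2 + nExtra ; δ = transition ∘ decodePhase }

  step-mark : ∀ {b b' p x r} → negator inNVars b ≡ (b' , just p) →
              step machine (conf (encodePhase marking) [] (bitSym b) (x ∷ r) [])
                ≡ just (conf (encodePhase (scanning p)) [ marker b' ] x r [] , nothing)
  step-mark {b} eq rewrite onBit-bitSym (mark ∘ negator inNVars) b | eq = refl

  step-scan : ∀ {p b b' p' lt x r bf} → negator p b ≡ (b' , just p') →
              step machine (conf (encodePhase (scanning p)) lt (bitSym b) (x ∷ r) bf)
                ≡ just (conf (encodePhase (scanning p')) (bitSym b' ∷ lt) x r bf , nothing)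
  step-scan {p} {b} eq
    rewrite decodePhase-encodePhase (scanning p) | onBit-bitSym (scan ∘ negator p) b | eq = refl

  step-scan-end : ∀ {p b b' x lt r bf} → negator p b ≡ (b' , nothing) →
                  step machine (conf (encodePhase (scanning p)) (x ∷ lt) (bitSym b) r bf)
                    ≡ just (conf (encodePhase rewinding) lt x (bitSym b' ∷ r) bf , nothing)
  step-scan-end {p} {b} eq
    rewrite decodePhase-encodePhase (scanning p) | onBit-bitSym (scan ∘ negator p) b | eq = refl

  step-rewind : ∀ a {x lt r bf} →
                step machine (conf (encodePhase rewinding) (x ∷ lt) (bitSym a) r bf)
                  ≡ just (conf (encodePhase rewinding) lt x (bitSym a ∷ r) bf , nothing)
  step-rewind false = refl
  step-rewind true  = refl

  step-unmark : ∀ c {lt r bf} →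
                step machine (conf (encodePhase rewinding) lt (marker c) r bf)
                  ≡ just (conf (encodePhase (running zero)) lt (bitSym c) r bf , nothing)
  step-unmark false = refl
  step-unmark true  = refl

  embedConfig : Config M → Config machine
  embedConfig (conf q l h r bf) =
    conf (encodePhase (running q)) (map embed l) (embed h) (map embed r) (complement bf)

  moveHead-embed : ∀ mv l w r → moveHead machine mv (map embed l) (embed w) (map embed r)
                                  ≡ Product.map (map embed) (Product.map embed (map embed)) (moveHead M mv l w r)
  moveHead-embed left  []      w r       = refl
  moveHead-embed left  (x ∷ l) w r       = refl
  moveHead-embed right l       w []      = refl
  moveHead-embed right l       w (x ∷ r) = refl
  moveHead-embed stay  l       w r       = refl

  doOut-complement : ∀ o bf → doOut machine (complementOut o) (complement bf)
                                ≡ Product.map complement (Maybe.map complement) (doOut M o bf)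
  doOut-complement none        bf = refl
  doOut-complement (emitBit b) bf = cong (_, nothing) (sym (map-++ not bf [ b ]))
  doOut-complement flush       bf = refl

  step-embed : ∀ c → step machine (embedConfig c)
                       ≡ Maybe.map (Product.map embedConfig (Maybe.map complement)) (step M c)
  step-embed (conf q l h r bf) rewrite unembed-embed h with δ q h
  ... | nothing                = refl
  ... | just (q' , w , mv , o) rewrite moveHead-embed mv l w r | doOut-complement o bf = refl

  space-embed : ∀ c → space machine (embedConfig c) ≤ space M c
  space-embed (conf q l h r bf) =
    ≤-reflexive (cong₂ (λ m n → m + suc n) (length-map embed l) (length-map embed r))

  -- The marked first cell remembers the bit c; u lists the cells between it and the head, nearest first.
  markedConfig : Phase → Bool → List Bool → Bool → List Bool → Config machine
  markedConfig ph c u b w = conf (encodePhase ph) (map bitSym u ++ [ marker c ]) (bitSym b) (map bitSym w) []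

  runningConfig : Bool → List Bool → Config machine
  runningConfig b w = conf (encodePhase (running zero)) [] (bitSym b) (map bitSym w) []

  embedConfig-initConfig : ∀ b w → embedConfig (initConfig M (b ∷ w)) ≡ runningConfig b w
  embedConfig-initConfig b w =
    cong₂ (λ h r → conf (encodePhase (running zero)) [] h r []) (embed-bitSym b)
          (trans (sym (map-∘ w)) (map-cong embed-bitSym w))

  space-markedConfig : ∀ ph c u b w →
                       space machine (markedConfig ph c u b w) ≡ length u + suc (suc (length w))
  space-markedConfig ph c []      b w = cong (2 +_) (length-map bitSym w)
  space-markedConfig ph c (v ∷ u) b w = cong suc (space-markedConfig ph c u b w)

  markedConfig-within : ∀ {s} ph c u b w → length u + suc (suc (length w)) ≤ s →
                        space machine (markedConfig ph c u b w) ≤ s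
  markedConfig-within ph c u b w = ≤-trans (≤-reflexive (space-markedConfig ph c u b w))

  rewind-marked : ∀ {s} c u a r → length u + suc (suc (length r)) ≤ s →
                  Silent machine s (markedConfig rewinding c u a r) (length u + 2)
                                   (runningConfig c (u ʳ++ a ∷ r))
  rewind-marked c []      a r ≤s =
    next (step-rewind a) (markedConfig-within rewinding c [] a r ≤s)
         (next (step-unmark c) (markedConfig-within rewinding c [] a r ≤s) done)
  rewind-marked c (v ∷ u) a r ≤s =
    next (step-rewind a) (markedConfig-within rewinding c (v ∷ u) a r ≤s)
         (rewind-marked c u v (a ∷ r) (≤-trans (≤-reflexive (+-suc _ _)) ≤s))

  scan-marked : ∀ {s p b w w'} c u → Transduces p (b ∷ w) w' → length u + suc (suc (length w)) ≤ s →
                Silent machine s (markedConfig (scanning p) c u b w) (length u + 2 * length (b ∷ w))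
                                 (runningConfig c (u ʳ++ w'))
  scan-marked {p = p} {b} c [] (finish eq) ≤s =
    next (step-scan-end eq) (markedConfig-within (scanning p) c [] b [] ≤s) (next (step-unmark c) ≤s done)
  scan-marked {p = p} {b} c (v ∷ u) (finish {b' = b'} eq) ≤s =
    next (step-scan-end eq) (markedConfig-within (scanning p) c (v ∷ u) b [] ≤s)
         (rewind-marked c u v [ b' ] (≤-trans (≤-reflexive (+-suc _ _)) ≤s))
  scan-marked c u (advance {w = []} _ ())
  scan-marked {s} {p} {b} c u (advance {b' = b'} {w = x ∷ w} {w'} eq t) ≤s =
    subst (λ k → Silent machine s (markedConfig (scanning p) c u b (x ∷ w)) k
                                  (runningConfig c (u ʳ++ b' ∷ w')))
          (steps (length u) (length w))
          (next (step-scan eq) (markedConfig-within (scanning p) c u b (x ∷ w) ≤s)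
                (scan-marked c (b' ∷ u) t (≤-trans (≤-reflexive (sym (+-suc _ _))) ≤s)))
    where
    steps : ∀ m n → suc (suc m + 2 * suc n) ≡ m + 2 * suc (suc n)
    steps = solve-∀

  preprocess : ∀ {s w w'} → Transduces inNVars w w' → length w ≤ s →
               ∃[ k ] k ≤ length w + length w ×
                      Silent machine s (initConfig machine w) k (embedConfig (initConfig M w'))
  preprocess (finish {b = false} ())
  preprocess (finish {b = true}  ())
  preprocess (advance {w = []} _ ())
  preprocess {s} (advance {b = b} {b'} {w = x ∷ w} {w'} eq t) ≤s =
    suc (2 * length (x ∷ w)) , ≤-trans (n≤1+n _) (≤-reflexive (steps (length w))) ,
    subst (Silent machine s (initConfig machine (b ∷ x ∷ w)) _) (sym (embedConfig-initConfig b' w'))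
          (next (step-mark eq) (≤-trans (≤-reflexive (cong (2 +_) (length-map (bitSym {2 + nExtra}) w))) ≤s)
                (scan-marked b' [] t ≤s))
    where
    steps : ∀ n → suc (suc (2 * suc n)) ≡ suc (suc n) + suc (suc n)
    steps = solve-∀

  lists-negateRHS : ∀ {P Q : List Bool → Set} {d s} φ → (∀ σ → Q σ ⇔ P (complement σ)) →
                    length (encode φ) ≤ s → ListsWithin M (encode (negateRHS φ)) P d s →
                    ListsWithin machine (encode φ) Q (d + (length (encode φ) + length (encode φ))) s
  lists-negateRHS φ Q⇔P L≤s (outs , run , unique , spec) with preprocess (transduces-encode φ) L≤s
  ... | k , k≤ , prefix =
    map complement outs ,
    Runs-prepend prefix (Runs-delay (≤-trans (≤-reflexive (+-identityʳ k)) k≤)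
                                    (Runs-simulate embedConfig complement step-embed space-embed run)) ,
    Unique.map⁺ complement-injective unique ,
    λ σ → ⇔.trans (∈-map-complement outs) (⇔.trans (spec (complement σ)) (⇔.sym (Q⇔P σ)))

PolyDelaySpaceEnumerable-negateRHS : ∀ {P Q : XorCNF → List Bool → Set} →
           (∀ φ σ → Q φ σ ⇔ P (negateRHS φ) (complement σ)) →
           PolyDelaySpaceEnumerable P → PolyDelaySpaceEnumerable Q
PolyDelaySpaceEnumerable-negateRHS {P} {Q} Q⇔P (M , c , lists) = Complementing.machine M , 2 + c , lists′
  where
  lists′ : ∀ φ → ListsWithin (Complementing.machine M) (encode φ) (Q φ)
                   ((length (encode φ) + 2) ^ (2 + c)) ((length (encode φ) + 2) ^ (2 + c))
  lists′ φ = ListsWithin-mono slack ≤-refl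
               (Complementing.lists-negateRHS M φ (Q⇔P φ) L≤ (ListsWithin-mono ≤-refl x≤ lists-negated))
    where
    L = length (encode φ)
    x = (L + 2) ^ c
    slack : x + (L + L) ≤ (L + 2) ^ (2 + c)
    slack = poly-slack L c
    x≤ : x ≤ (L + 2) ^ (2 + c)
    x≤ = ≤-trans (m≤m+n x (L + L)) slack
    L≤ : L ≤ (L + 2) ^ (2 + c)
    L≤ = ≤-trans (≤-trans (m≤m+n L L) (m≤n+m (L + L) x)) slack
    lists-negated : ListsWithin M (encode (negateRHS φ)) (P (negateRHS φ)) x x
    lists-negated =
      subst (λ n → ListsWithin M (encode (negateRHS φ)) (P (negateRHS φ)) ((n + 2) ^ c) ((n + 2) ^ c))
            (length-encode-negateRHS φ) (lists (negateRHS φ))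

proposition1 : PolyDelaySpaceEnumerable IsMinimalSignature ⇔ PolyDelaySpaceEnumerable IsMaximalSignature
proposition1 = mk⇔ (PolyDelaySpaceEnumerable-negateRHS IsMaximalSignature⇔IsMinimalSignature-negateRHS)
                   (PolyDelaySpaceEnumerable-negateRHS IsMinimalSignature⇔IsMaximalSignature-negateRHS)
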